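{- Let $x,y$ be Fibonacci strings of length $n$ with $y=x+\delta_i$ and $x_i=1$. Then for every $j\in[1,n]$, if $x+\delta_j$ is a Fibonacci string then $y+\delta_j$ is a Fibonacci string.
   Context: A Fibonacci string is a binary string with no two consecutive 1's. For a binary string $x=x_1\ldots x_n$ and $i\in[1,n]$, $x+\delta_i$ denotes the string obtained from $x$ by complementing its $i$-th coordinate. -}

module Defs where

open import Data.Bool using (Bool; true; false; not)
open import Data.Nat using (ℕ)
open import Data.Fin using (Fin)
open import Data.Vec using (Vec; []; _∷_; lookup; updateAt)
open import Data.Empty using (⊥)
open import Data.Unit using (⊤)

BinString : ℕ → Set
BinString n = Vec Bool n

IsFib : ∀ {n} → BinString n → Set
IsFib [] = ⊤
IsFib (_ ∷ []) = ⊤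
IsFib (true ∷ true ∷ _) = ⊥
IsFib (true ∷ false ∷ xs) = IsFib (false ∷ xs)
IsFib (false ∷ b ∷ xs) = IsFib (b ∷ xs)

-- x + δ_i : complement the i-th coordinate (indices 0-based via Fin n).
flip : ∀ {n} → BinString n → Fin n → BinString n
flip x i = updateAt x i not

{-# OPTIONS --safe #-}
module Submission where

-- Fibonacci strings form a down-set for the coordinatewise order 0 ≤ 1. Complementing
-- distinct coordinates commutes, so for j ≢ i the string y + δ_j is x + δ_j with its
-- 1 at position i turned off, hence lies below the Fibonacci string x + δ_j; for
-- j ≡ i it is x itself.

open import Defs
open import Data.Nat using (ℕ)
open import Data.Bool using (true; false; _≤_; f≤t; b≤b)
open import Data.Bool.Properties using (not-involutive)
open import Data.Fin using (Fin; zero; suc; _≟_)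
open import Data.Vec using ([]; _∷_; lookup)
open import Data.Vec.Properties using (updateAt-updateAt-local; updateAt-id; updateAt-commutes; lookup∘updateAt′)
open import Data.Vec.Relation.Binary.Pointwise.Inductive as Pointwise using (Pointwise; []; _∷_)
open import Data.Unit using (tt)
open import Function using (id)
open import Relation.Nullary using (yes; no)
open import Relation.Binary.PropositionalEquality using (_≡_; _≢_; refl; subst; sym; trans)

infix 4 _⊑_

_⊑_ : ∀ {n} → BinString n → BinString n → Set
_⊑_ = Pointwise _≤_

⊑-refl : ∀ {n} {x : BinString n} → x ⊑ x
⊑-refl = Pointwise.refl b≤b

IsFib-tail : ∀ {n} b (x : BinString n) → IsFib (b ∷ x) → IsFib x
IsFib-tail b     []            _   = tt
IsFib-tail true  (false ∷ x)   fib = fib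
IsFib-tail false (c ∷ x)       fib = fib

IsFib-antitone : ∀ {n} {x y : BinString n} → x ⊑ y → IsFib y → IsFib x
IsFib-antitone []              _   = tt
IsFib-antitone (_ ∷ [])        _   = tt
IsFib-antitone {x = false ∷ _ ∷ _} {c ∷ y} (_ ∷ x⊑y) fib = IsFib-antitone x⊑y (IsFib-tail c y fib)
IsFib-antitone {x = true ∷ false ∷ _} {true ∷ false ∷ _} (_ ∷ _ ∷ x⊑y) fib = IsFib-antitone (b≤b ∷ x⊑y) fib
IsFib-antitone {x = true ∷ true ∷ _} {true ∷ true ∷ _} _ ()

flip-one-⊑ : ∀ {n} (x : BinString n) (i : Fin n) → lookup x i ≡ true → flip x i ⊑ x
flip-one-⊑ (true ∷ x) zero    refl   = f≤t ∷ ⊑-refl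
flip-one-⊑ (b ∷ x)    (suc i) xᵢ≡1 = b≤b ∷ flip-one-⊑ x i xᵢ≡1

flip-involutive : ∀ {n} (x : BinString n) (i : Fin n) → flip (flip x i) i ≡ x
flip-involutive x i =
  trans (updateAt-updateAt-local i {h = id} x (not-involutive (lookup x i))) (updateAt-id i x)

flip-flip-one-⊑ : ∀ {n} (x : BinString n) {i j : Fin n} → i ≢ j → lookup x i ≡ true →
                  flip (flip x i) j ⊑ flip x j
flip-flip-one-⊑ x {i} {j} i≢j xᵢ≡1 =
  subst (_⊑ flip x j) (updateAt-commutes i j i≢j x)
        (flip-one-⊑ (flip x j) i (subst (_≡ true) (sym (lookup∘updateAt′ i j i≢j x)) xᵢ≡1))

mainTheorem5 : (n : ℕ) (x y : BinString n) (i : Fin n) →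
    IsFib x → IsFib y → y ≡ flip x i → lookup x i ≡ true →
    (j : Fin n) → IsFib (flip x j) → IsFib (flip y j)
mainTheorem5 n x _ i fibx _ refl xᵢ≡1 j fibxⱼ with i ≟ j
... | yes refl = subst IsFib (sym (flip-involutive x i)) fibx
... | no i≢j   = IsFib-antitone (flip-flip-one-⊑ x i≢j xᵢ≡1) fibxⱼ
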